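{- Let $\mathcal{S}\in\mathfrak{S}_{\mathrm{ti}}\cup\mathfrak{S}_{\mathrm{diag}}$ be an SSM with $L$ layers and dimension $d$, operating over fixed-point arithmetic with bit-width $b$. If $\mathcal{S}$ accepts a word $w$, then there exists a word $w'$ of length at most $2^{2Ldb}$ such that $\mathcal{S}$ accepts $w'$.
   Context: A feedforward neural network (FNN) is a composition of layers of nodes, each node computing $\mathbf{x}\mapsto\mathit{relu}(\sum_i c_ix_i+b)$ with $\mathit{relu}(x)=\max(0,x)$. An SSM layer of dimension $d$ is a tuple $(\mathbf{h}_0,\mathit{gate},\mathit{inc},\phi)$ with $\mathbf{h}_0\in\mathbb{R}^d$, $\mathit{gate}\colon\mathbb{R}^d\to\mathbb{R}^{d\times d}$, $\mathit{inc}\colon\mathbb{R}^d\to\mathbb{R}^d$, $\phi\colon\mathbb{R}^d\times\mathbb{R}^d\to\mathbb{R}^d$ (computed by an FNN); on input $\mathbf{x}_1\cdots\mathbf{x}_k$ it computes $\mathbf{h}_t=\mathit{gate}(\mathbf{x}_t)\mathbf{h}_{t-1}+\mathit{inc}(\mathbf{x}_t)$ and outputs $\mathbf{z}_t=\phi(\mathbf{h}_t,\mathbf{x}_t)$. An SSM over a finite alphabet $\Sigma$ with $L$ layers is a tuple $(\mathit{emb},l_1,\dots,l_L,\mathit{out})$ with $\mathit{emb}\colon\Sigma\to\mathbb{R}^d$, SSM layers $l_j$, and $\mathit{out}$ computed by an FNN; on $w=a_1\cdots a_k$ it sets $\mathbf{x}^0_i=\mathit{emb}(a_i)$, lets layer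 $l_j$ map $\mathbf{x}^{j-1}_1\cdots\mathbf{x}^{j-1}_k$ to $\mathbf{x}^{j}_1\cdots\mathbf{x}^{j}_k$, and outputs $\mathcal{S}(w)=\mathit{out}(\mathbf{x}^L_k)$; $\mathcal{S}$ accepts $w$ iff $\mathcal{S}(w)=1$. $\mathfrak{S}_{\mathrm{ti}}$: every $\mathit{gate}$ is a constant matrix; $\mathfrak{S}_{\mathrm{diag}}$: every $\mathit{gate}(\mathbf{x})$ is diagonal. Operating over fixed-point arithmetic with bit-width $b$ means all values and computations in the evaluation of $\mathcal{S}$ are represented/carried out with $b$ bits. -}

module Defs where

open import Data.Bool using (Bool)
open import Data.Nat using (ℕ; _+_; _*_)
open import Data.Fin using (Fin; combine)
open import Data.Vec using (Vec; []; _∷_; lookup; map; foldr′; tabulate; zipWith; _++_)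
open import Data.Vec.Relation.Unary.All using (All)
open import Data.List as List using (List; last)
open import Data.Maybe as Maybe using (Maybe; just)
open import Data.Product using (_×_; _,_)
open import Relation.Binary.PropositionalEquality using (_≡_; _≢_)

Bits : ℕ → Set
Bits b = Vec Bool b

-- The concrete rounding/overflow scheme is left arbitrary (the result is
-- stated for every such arithmetic).
record FixedPoint (b : ℕ) : Set where
  field
    _⊕_ : Bits b → Bits b → Bits b
    _⊗_ : Bits b → Bits b → Bits b
    𝟘   : Bits b
    𝟙   : Bits b
    relu : Bits b → Bits b

module _ {b : ℕ} (A : FixedPoint b) where
  open FixedPoint A

  dot : ∀ {k} → Vec (Bits b) k → Vec (Bits b) k → Bits b
  dot c x = foldr′ _⊕_ 𝟘 (zipWith _⊗_ c x)

  FNNLayer : ℕ → ℕ → Set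
  FNNLayer k m = Vec (Vec (Bits b) k × Bits b) m

  evalLayer : ∀ {k m} → FNNLayer k m → Vec (Bits b) k → Vec (Bits b) m
  evalLayer ly x = map (λ { (c , bias) → relu (dot c x ⊕ bias) }) ly

  data FNN (n : ℕ) : ℕ → Set where
    input : FNN n n
    _▷_   : ∀ {k m} → FNN n k → FNNLayer k m → FNN n m

  evalFNN : ∀ {n m} → FNN n m → Vec (Bits b) n → Vec (Bits b) m
  evalFNN input    x = x
  evalFNN (f ▷ ly) x = evalLayer ly (evalFNN f x)

  record SSMLayer (d : ℕ) : Set where
    field
      h₀   : Vec (Bits b) d
      gate : FNN d (d * d)       -- ℝ^d → ℝ^{d×d} (row-major via combine)
      inc  : FNN d d
      φ    : FNN (d + d) d

  gateMat : ∀ {d} → SSMLayer d → Vec (Bits b) d → Fin d → Fin d → Bits b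
  gateMat l x i j = lookup (evalFNN (SSMLayer.gate l) x) (combine i j)

  step : ∀ {d} → SSMLayer d → Vec (Bits b) d → Vec (Bits b) d → Vec (Bits b) d
  step l h x = tabulate (λ i → dot (tabulate (gateMat l x i)) h
                               ⊕ lookup (evalFNN (SSMLayer.inc l) x) i)

  runLayerFrom : ∀ {d} → SSMLayer d → Vec (Bits b) d → List (Vec (Bits b) d) → List (Vec (Bits b) d)
  runLayerFrom l h List.[] = List.[]
  runLayerFrom l h (x List.∷ xs) =
    evalFNN (SSMLayer.φ l) (step l h x ++ x) List.∷ runLayerFrom l (step l h x) xs

  runLayer : ∀ {d} → SSMLayer d → List (Vec (Bits b) d) → List (Vec (Bits b) d)
  runLayer l = runLayerFrom l (SSMLayer.h₀ l)

  runLayers : ∀ {d L} → Vec (SSMLayer d) L → List (Vec (Bits b) d) → List (Vec (Bits b) d)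
  runLayers [] xs = xs
  runLayers (l ∷ ls) xs = runLayers ls (runLayer l xs)

  record SSM (n d L : ℕ) : Set where
    field
      emb    : Fin n → Vec (Bits b) d
      layers : Vec (SSMLayer d) L
      out    : FNN d 1

  -- S(w) = out(x^L_k); undefined (not accepted) on the empty word
  output : ∀ {n d L} → SSM n d L → List (Fin n) → Maybe (Vec (Bits b) 1)
  output S w = Maybe.map (evalFNN (SSM.out S))
                 (last (runLayers (SSM.layers S) (List.map (SSM.emb S) w)))

  Accepts : ∀ {n d L} → SSM n d L → List (Fin n) → Set
  Accepts S w = output S w ≡ just (𝟙 ∷ [])

  IsTI : ∀ {d} → SSMLayer d → Set
  IsTI {d} l = ∀ (x y : Vec (Bits b) d) i j → gateMat l x i j ≡ gateMat l y i j

  IsDiag : ∀ {d} → SSMLayer d → Set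
  IsDiag {d} l = ∀ (x : Vec (Bits b) d) (i j : Fin d) → i ≢ j → gateMat l x i j ≡ 𝟘

  InTI : ∀ {n d L} → SSM n d L → Set
  InTI S = All IsTI (SSM.layers S)

  InDiag : ∀ {n d L} → SSM n d L → Set
  InDiag S = All IsDiag (SSM.layers S)

{-# OPTIONS --safe #-}

-- In fixed-point arithmetic the hidden states of the L layers together range over a set
-- of 2^(bdL) values, so the SSM is a finite Mealy machine and the pumping argument
-- applies: in a word longer than the number of states two prefixes lead to the same
-- state, and cutting out the segment between them does not change the final output.

module Submission where

open import Defs
open import Data.Nat using (ℕ; _≤_; _^_; _*_)
open import Data.Fin using (Fin)
open import Data.List using (List; length)
open import Data.Sum using (_⊎_)
open import Data.Product using (∃; _×_)

open import Data.Nat using (_+_; _∸_; _<_; _≤?_)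
open import Data.Nat.Properties
  using (≤-trans; m≤m+n; n<1+n; ≰⇒>; m≤n⇒m⊓n≡m; m<n⇒0<n∸m; m+[n∸m]≡n;
         +-monoˡ-<; <⇒≢; <⇒≤; <-≤-trans; ≤-<-trans; ^-*-assoc; ^-monoʳ-≤)
open import Data.Nat.Induction using (<-wellFounded)
open import Data.Nat.Tactic.RingSolver using (solve-∀)
open import Data.Fin using (toℕ; combine)
open import Data.Fin.Properties using (pigeonhole; toℕ≤pred[n]; 2↔Bool; combine-injective)
open import Data.List using ([]; _∷_; _++_; map; take; drop; foldl; last)
open import Data.List.Properties using (length-++; length-take; length-drop; take++drop≡id)
open import Data.Vec using (Vec; []; _∷_)
import Data.Vec as Vec
open import Data.Maybe using (Maybe)
import Data.Maybe as Maybe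
open import Data.Product using (_,_; proj₁; proj₂)
open import Function using (_∘_)
open import Function.Bundles using (_↣_; mk↣; Injection)
open import Function.Properties.Inverse using (↔⇒↣)
open import Function.Construct.Symmetry using (↔-sym)
open import Induction.WellFounded using (Acc; acc)
open import Relation.Binary.PropositionalEquality
open import Relation.Nullary using (yes; no; ¬_; contradiction)

last-++ : ∀ {A : Set} (xs : List A) {ys} → ¬ ys ≡ [] → last (xs ++ ys) ≡ last ys
last-++ []                  _     = refl
last-++ (x ∷ xs)      {[]}    ys≢[] = contradiction refl ys≢[]
last-++ (x ∷ [])      {_ ∷ _} _     = refl
last-++ (x ∷ x′ ∷ xs) {_ ∷ _} ys≢[] = last-++ (x′ ∷ xs) ys≢[]

drop-≢[] : ∀ {A : Set} j (w : List A) → j < length w → ¬ drop j w ≡ []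
drop-≢[] j w j<|w| drop≡[] =
  <⇒≢ (m<n⇒0<n∸m j<|w|) (sym (trans (sym (length-drop j w)) (cong length drop≡[])))

length-take++drop-< : ∀ {A : Set} {i j} (w : List A) → i < j → j ≤ length w →
                      length (take i w ++ drop j w) < length w
length-take++drop-< {i = i} {j} w i<j j≤|w| = begin-strict
  length (take i w ++ drop j w)  ≡⟨ length-++ (take i w) ⟩
  length (take i w) + length (drop j w)
    ≡⟨ cong₂ _+_ (trans (length-take i w) (m≤n⇒m⊓n≡m (<⇒≤ (<-≤-trans i<j j≤|w|))))
                 (length-drop j w) ⟩
  i + (length w ∸ j)             <⟨ +-monoˡ-< (length w ∸ j) i<j ⟩
  j + (length w ∸ j)             ≡⟨ m+[n∸m]≡n j≤|w| ⟩
  length w                       ∎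
  where open Data.Nat.Properties.≤-Reasoning

Mealy : Set → Set → Set → Set
Mealy S I O = S → I → S × O

precompose : ∀ {S I J O} → (J → I) → Mealy S I O → Mealy S J O
precompose f m s = m s ∘ f

cascade : ∀ {S I L} → Vec (Mealy S I I) L → Mealy (Vec S L) I I
cascade []       []       x = [] , x
cascade (m ∷ ms) (s ∷ ss) x =
  let s′ , y = m s x ; ss′ , z = cascade ms ss y in s′ ∷ ss′ , z

module _ {S I O : Set} (m : Mealy S I O) where

  next : S → I → S
  next s x = proj₁ (m s x)

  after : S → List I → S
  after = foldl next

  run : S → List I → List O
  run s []       = []
  run s (x ∷ xs) = proj₂ (m s x) ∷ run (next s x) xs

  finalOutput : S → List I → Maybe O
  finalOutput s w = last (run s w)

  run-++ : ∀ s u v → run s (u ++ v) ≡ run s u ++ run (after s u) v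
  run-++ s []      v = refl
  run-++ s (x ∷ u) v = cong (_ ∷_) (run-++ (next s x) u v)

  run-≢[] : ∀ s {w} → ¬ w ≡ [] → ¬ run s w ≡ []
  run-≢[] s {[]}    w≢[] = contradiction refl w≢[]
  run-≢[] s {_ ∷ _} _    ()

  finalOutput-++ : ∀ s u {v} → ¬ v ≡ [] → finalOutput s (u ++ v) ≡ finalOutput (after s u) v
  finalOutput-++ s u {v} v≢[] = begin
    last (run s (u ++ v))                 ≡⟨ cong last (run-++ s u v) ⟩
    last (run s u ++ run (after s u) v)   ≡⟨ last-++ (run s u) (run-≢[] (after s u) v≢[]) ⟩
    last (run (after s u) v)              ∎
    where open ≡-Reasoning

  finalOutput-cutLoop : ∀ s {i j} (w : List I) → j < length w →
                        after s (take i w) ≡ after s (take j w) →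
                        finalOutput s (take i w ++ drop j w) ≡ finalOutput s w
  finalOutput-cutLoop s {i} {j} w j<|w| loop = begin
    finalOutput s (take i w ++ drop j w)          ≡⟨ finalOutput-++ s (take i w) rest≢[] ⟩
    finalOutput (after s (take i w)) (drop j w)   ≡⟨ cong (λ t → finalOutput t (drop j w)) loop ⟩
    finalOutput (after s (take j w)) (drop j w)   ≡⟨ finalOutput-++ s (take j w) rest≢[] ⟨
    finalOutput s (take j w ++ drop j w)          ≡⟨ cong (finalOutput s) (take++drop≡id j w) ⟩
    finalOutput s w                               ∎
    where
      open ≡-Reasoning
      rest≢[] : ¬ drop j w ≡ []
      rest≢[] = drop-≢[] j w j<|w|

  module _ {K : ℕ} (state↣ : S ↣ Fin K) where
    open Injection state↣ using (to; injective)

    removeLoop : ∀ s (w : List I) → K < length w →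
                 ∃ λ w′ → length w′ < length w × finalOutput s w′ ≡ finalOutput s w
    removeLoop s w K<|w|
      with i , j , i<j , same ← pigeonhole (n<1+n K) (λ k → to (after s (take (toℕ k) w)))
      = take (toℕ i) w ++ drop (toℕ j) w
      , length-take++drop-< w i<j (<⇒≤ j<|w|)
      , finalOutput-cutLoop s {toℕ i} w j<|w| (injective same)
      where
        j<|w| : toℕ j < length w
        j<|w| = ≤-<-trans (toℕ≤pred[n] j) K<|w|

    shorten : ∀ s (w : List I) → ∃ λ w′ → length w′ ≤ K × finalOutput s w′ ≡ finalOutput s w
    shorten s w = go w (<-wellFounded (length w))
      where
        go : ∀ w → Acc _<_ (length w) → ∃ λ w′ → length w′ ≤ K × finalOutput s w′ ≡ finalOutput s w
        go w (acc shorter) with length w ≤? K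
        ... | yes |w|≤K = w , |w|≤K , refl
        ... | no  |w|≰K with w′ , w′<w , same ← removeLoop s w (≰⇒> |w|≰K)
          with w″ , |w″|≤K , same′ ← go w′ (shorter w′<w)
          = w″ , |w″|≤K , trans same′ same

run-cascade-[] : ∀ {S I : Set} (xs : List I) → run (cascade {S} []) [] xs ≡ xs
run-cascade-[] []       = refl
run-cascade-[] (x ∷ xs) = cong (x ∷_) (run-cascade-[] xs)

run-cascade-∷ : ∀ {S I L} (m : Mealy S I I) (ms : Vec (Mealy S I I) L) s ss xs →
                run (cascade (m ∷ ms)) (s ∷ ss) xs ≡ run (cascade ms) ss (run m s xs)
run-cascade-∷ m ms s ss []       = refl
run-cascade-∷ m ms s ss (x ∷ xs) = cong (_ ∷_) (run-cascade-∷ m ms _ _ xs)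

run-precompose : ∀ {S I J O} (f : J → I) (m : Mealy S I O) s w →
                 run (precompose f m) s w ≡ run m s (map f w)
run-precompose f m s []      = refl
run-precompose f m s (x ∷ w) = cong (_ ∷_) (run-precompose f m _ w)

Vec↣Fin^ : ∀ {A : Set} {k m} → A ↣ Fin k → Vec A m ↣ Fin (k ^ m)
Vec↣Fin^ {A} {k} A↣ = mk↣ (encode-injective _ _)
  where
    open Injection A↣ using (to; injective)

    encode : ∀ {m} → Vec A m → Fin (k ^ m)
    encode []       = Data.Fin.zero
    encode (x ∷ xs) = combine (to x) (encode xs)

    encode-injective : ∀ {m} (xs ys : Vec A m) → encode xs ≡ encode ys → xs ≡ ys
    encode-injective []       []       _    = refl
    encode-injective (x ∷ xs) (y ∷ ys) same
      with x≡y , xs≡ys ← combine-injective (to x) (encode xs) (to y) (encode ys) same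
      = cong₂ _∷_ (injective x≡y) (encode-injective xs ys xs≡ys)

Bits↣Fin : ∀ {b} → Bits b ↣ Fin (2 ^ b)
Bits↣Fin = Vec↣Fin^ (↔⇒↣ (↔-sym 2↔Bool))

module _ {b : ℕ} (A : FixedPoint b) {d : ℕ} where

  Hidden : Set
  Hidden = Vec (Bits b) d

  layerMealy : SSMLayer A d → Mealy Hidden Hidden Hidden
  layerMealy l h x = step A l h x , evalFNN A (SSMLayer.φ l) (step A l h x Vec.++ x)

  runLayerFrom≡run : ∀ l h xs → runLayerFrom A l h xs ≡ run (layerMealy l) h xs
  runLayerFrom≡run l h []       = refl
  runLayerFrom≡run l h (x ∷ xs) = cong (_ ∷_) (runLayerFrom≡run l (step A l h x) xs)

  runLayers≡run-cascade : ∀ {L} (ls : Vec (SSMLayer A d) L) xs →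
    runLayers A ls xs ≡ run (cascade (Vec.map layerMealy ls)) (Vec.map SSMLayer.h₀ ls) xs
  runLayers≡run-cascade []       xs = sym (run-cascade-[] xs)
  runLayers≡run-cascade (l ∷ ls) xs = begin
    runLayers A ls (runLayer A l xs)
      ≡⟨ runLayers≡run-cascade ls (runLayer A l xs) ⟩
    run (cascade (Vec.map layerMealy ls)) (Vec.map SSMLayer.h₀ ls) (runLayer A l xs)
      ≡⟨ cong (run _ _) (runLayerFrom≡run l (SSMLayer.h₀ l) xs) ⟩
    run (cascade (Vec.map layerMealy ls)) (Vec.map SSMLayer.h₀ ls)
        (run (layerMealy l) (SSMLayer.h₀ l) xs)
      ≡⟨ run-cascade-∷ (layerMealy l) _ (SSMLayer.h₀ l) _ xs ⟨
    run (cascade (Vec.map layerMealy (l ∷ ls))) (Vec.map SSMLayer.h₀ (l ∷ ls)) xs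
      ∎
    where open ≡-Reasoning

  module _ {n L : ℕ} (S : SSM A n d L) where
    open SSM S

    ssmMealy : Mealy (Vec Hidden L) (Fin n) Hidden
    ssmMealy = precompose emb (cascade (Vec.map layerMealy layers))

    initialState : Vec Hidden L
    initialState = Vec.map SSMLayer.h₀ layers

    output≡finalOutput : ∀ w →
      output A S w ≡ Maybe.map (evalFNN A out) (finalOutput ssmMealy initialState w)
    output≡finalOutput w = cong (Maybe.map (evalFNN A out) ∘ last) (begin
      runLayers A layers (map emb w)
        ≡⟨ runLayers≡run-cascade layers _ ⟩
      run (cascade (Vec.map layerMealy layers)) initialState (map emb w)
        ≡⟨ run-precompose emb _ _ w ⟨
      run ssmMealy initialState w
        ∎)
      where open ≡-Reasoning

stateCount≤ : ∀ b d L → ((2 ^ b) ^ d) ^ L ≤ 2 ^ (2 * L * d * b)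
stateCount≤ b d L = begin
  ((2 ^ b) ^ d) ^ L            ≡⟨ cong (_^ L) (^-*-assoc 2 b d) ⟩
  (2 ^ (b * d)) ^ L            ≡⟨ ^-*-assoc 2 (b * d) L ⟩
  2 ^ (b * d * L)              ≤⟨ ^-monoʳ-≤ 2 (m≤m+n (b * d * L) (b * d * L)) ⟩
  2 ^ (b * d * L + b * d * L)  ≡⟨ cong (2 ^_) (exponent≡ b d L) ⟩
  2 ^ (2 * L * d * b)          ∎
  where
    open Data.Nat.Properties.≤-Reasoning
    exponent≡ : ∀ b d L → b * d * L + b * d * L ≡ 2 * L * d * b
    exponent≡ = solve-∀

lemma4 : ∀ {b n d L : ℕ} (A : FixedPoint b) (S : SSM A n d L) →
    InTI A S ⊎ InDiag A S →
    (w : List (Fin n)) → Accepts A S w →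
    ∃ λ (w′ : List (Fin n)) → length w′ ≤ 2 ^ (2 * L * d * b) × Accepts A S w′
lemma4 {b} {_} {d} {L} A S _ w accepts
  with w′ , |w′|≤K , same ← shorten (ssmMealy A S) (Vec↣Fin^ (Vec↣Fin^ Bits↣Fin))
                                     (initialState A S) w
  = w′ , ≤-trans |w′|≤K (stateCount≤ b d L) , trans sameOutput accepts
  where
    sameOutput : output A S w′ ≡ output A S w
    sameOutput = begin
      output A S w′                                                        ≡⟨ output≡finalOutput A S w′ ⟩
      Maybe.map (evalFNN A (SSM.out S)) (finalOutput (ssmMealy A S) _ w′)  ≡⟨ cong (Maybe.map _) same ⟩
      Maybe.map (evalFNN A (SSM.out S)) (finalOutput (ssmMealy A S) _ w)   ≡⟨ output≡finalOutput A S w ⟨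
      output A S w                                                         ∎
      where open ≡-Reasoning
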